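{- Let $(A,B)$ be an instance of 3-Partition and let $\Phi(A,B)=(S,\mathrm{val},\mathcal{E},C)$ be the OCP instance constructed from it as described in the context. If $(A,B)$ is a YES instance of 3-Partition, then $\Phi(A,B)$ is a YES instance of OCP, with an optimal ordered covering achieving cost exactly $C$.
   Context: OCP: an instance consists of a finite label set $S$, a family $\mathcal{E}$ of finite sets with $S\subseteq\bigcup\mathcal{E}$, a weight function $\mathrm{val}$ assigning a positive integer to every element of $\bigcup\mathcal{E}$, and a budget $C\in\mathbb{N}$. An ordered covering is a tuple $\mathcal{E}'=(E'_1,\dots,E'_k)$ of members of $\mathcal{E}$ with $S\subseteq\bigcup_i E'_i$; its residual sets are $U_i=E'_i\setminus\bigcup_{j<i}E'_j$, residual weights $u_i=\sum_{x\in U_i}\mathrm{val}(x)$, partial costs $f(E'_i)=2^{u_i}$ if $u_i>0$ and $0$ if $u_i=0$, and total cost $F(\mathcal{E}')=\sum_i f(E'_i)$. The instance is a YES instance if some ordered covering has $F(\mathcal{E}')\le C$. 3-Partition: an instance is a multiset $A=\{a_1,\dots,a_{3m}\}$ of positive integers and a positive integer $B$ with $\sum_{i=1}^{3m}a_i=mB$ and $B/4<a_i<B/2$ for all $i$; it is a YES instance if the elements of $A$ (distinguished by index) can be partitioned into $m$ triplets each of sum $B$. The construction $\Phi(A,B)$: let $S=\{\alpha_1,\dots,\alpha_{3m}\}$ with $\mathrm{val}(\alpha_\ell)=a_\ell$ (distinct labels even for repeated values). Let $T$ be the collection of all 3-element subsets $X\subseteq S$ with $\sum_{\alpha\in X}\mathrm{val}(\alpha)=B$,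 enumerated as $X_1,\dots,X_{|T|}$. Set $t=1$ and $w=t+B+\lceil\log_2 m\rceil+1$. For each $i\in\{1,\dots,m\}$ and $j\in\{1,\dots,|T|\}$ introduce two new distinct elements $\omega_{ij},\tau_{ij}\notin S$ (all distinct across pairs $(i,j)$) with $\mathrm{val}(\omega_{ij})=w$ and $\mathrm{val}(\tau_{ij})=t$, and define the opening edge $A_{ij}=\{\omega_{ij}\}$ and the assignment edge $E_{ij}=X_j\cup\{\omega_{ij},\tau_{ij}\}$. Let $\mathcal{E}=\{A_{ij},E_{ij}: i\in\{1,\dots,m\}, j\in\{1,\dots,|T|\}\}$ and $C=m(2^w+2^{t+B})$. -}

module Defs where

open import Data.Nat using (ℕ; zero; suc; _+_; _*_; _^_; _≤_; _<_)
open import Data.Nat.Logarithm using (⌈log₂_⌉)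
open import Data.Fin using (Fin; toℕ)
import Data.Fin.Properties as FinP
open import Data.Nat.ListAction using (sum)
open import Data.List using (List; []; _∷_; _++_; [_]; map; filter; deduplicate; allFin)
open import Data.List.Relation.Unary.All using (All)
open import Data.List.Relation.Unary.Any using (Any)
open import Data.List.Membership.Propositional using (_∈_)
import Data.List.Membership.DecPropositional as DecMem
open import Data.Product using (Σ; _×_; _,_; ∃)
open import Relation.Binary.PropositionalEquality using (_≡_; refl; cong)
open import Relation.Binary.Definitions using (DecidableEquality)
open import Relation.Nullary using (¬_; ¬?; yes; no; Dec)
open import Data.Bool using (if_then_else_)
open import Relation.Nullary.Decidable using (⌊_⌋)

ΣFin : (n : ℕ) → (Fin n → ℕ) → ℕ
ΣFin n f = sum (map f (allFin n))

-- An instance: m, the multiset A = (a_0,…,a_{3m-1}) (indexed, so repeated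
-- values are distinguished by index), and B.
record IsThreePartitionInstance (m : ℕ) (A : Fin (3 * m) → ℕ) (B : ℕ) : Set where
  field
    B-pos   : 0 < B
    a-pos   : ∀ ℓ → 0 < A ℓ
    total   : ΣFin (3 * m) A ≡ m * B
    lower   : ∀ ℓ → B < 4 * A ℓ
    upper   : ∀ ℓ → 2 * A ℓ < B

-- YES instance: a partition of the indices into m triplets of sum B,
-- given as an assignment g of indices to triplet numbers whose every
-- class has exactly 3 elements and sum B.
ThreePartitionYes : (m : ℕ) → (Fin (3 * m) → ℕ) → ℕ → Set
ThreePartitionYes m A B =
  Σ (Fin (3 * m) → Fin m) λ g →
    ∀ (i : Fin m) →
      (ΣFin (3 * m) (λ ℓ → if ⌊ g ℓ FinP.≟ i ⌋ then 1 else 0) ≡ 3) ×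
      (ΣFin (3 * m) (λ ℓ → if ⌊ g ℓ FinP.≟ i ⌋ then A ℓ else 0) ≡ B)

record OCP : Set₁ where
  field
    Elem    : Set
    _≟ₑ_    : DecidableEquality Elem
    Edge    : Set                    -- the (index set of the) family ℰ
    members : Edge → List Elem
    S       : List Elem
    val     : Elem → ℕ
    budget  : ℕ

module OCPDefs (P : OCP) where
  open OCP P

  open DecMem _≟ₑ_ using (_∈?_)

  set : Edge → List Elem
  set e = deduplicate _≟ₑ_ (members e)

  ⋃ : List Edge → List Elem
  ⋃ [] = []
  ⋃ (e ∷ es) = set e ++ ⋃ es

  residualWeight : List Edge → Edge → ℕ
  residualWeight prev e = sum (map val (filter (λ x → ¬? (x ∈? ⋃ prev)) (set e)))

  partialCost : ℕ → ℕ
  partialCost zero    = 0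
  partialCost (suc u) = 2 ^ suc u

  costFrom : List Edge → List Edge → ℕ
  costFrom prev []       = 0
  costFrom prev (e ∷ es) = partialCost (residualWeight prev e) + costFrom (prev ++ [ e ]) es

  F : List Edge → ℕ
  F = costFrom []

  IsOrderedCovering : List Edge → Set
  IsOrderedCovering es = All (λ s → s ∈ ⋃ es) S

  IsYes : Set
  IsYes = Σ (List Edge) λ es → IsOrderedCovering es × F es ≤ budget

  IsOptimalCoveringOfCost : List Edge → ℕ → Set
  IsOptimalCoveringOfCost es c =
    IsOrderedCovering es × F es ≡ c ×
    (∀ es′ → IsOrderedCovering es′ → F es ≤ F es′)

module Φ (m : ℕ) (A : Fin (3 * m) → ℕ) (B : ℕ) where

  n : ℕ
  n = 3 * m

  -- 3-element subsets {α_a, α_b, α_c} (a < b < c) of S with weight B: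
  -- the collection T (canonical representation of each subset).
  record Triple : Set where
    constructor triple
    field
      a b c : Fin n
      a<b   : toℕ a < toℕ b
      b<c   : toℕ b < toℕ c
      sumB  : A a + A b + A c ≡ B

  t : ℕ
  t = 1

  w : ℕ
  w = t + B + ⌈log₂ m ⌉ + 1

  -- elements: α_ℓ, and ω_{iX}, τ_{iX} for X = {α_a,α_b,α_c}
  data Elem : Set where
    α : Fin n → Elem
    ω : Fin m → Fin n → Fin n → Fin n → Elem
    τ : Fin m → Fin n → Fin n → Fin n → Elem

  _≟E_ : DecidableEquality Elem
  α x ≟E α y with x FinP.≟ y
  ... | yes refl = yes refl
  ... | no p = no λ { refl → p refl }
  α _ ≟E ω _ _ _ _ = no λ ()
  α _ ≟E τ _ _ _ _ = no λ ()
  ω _ _ _ _ ≟E α _ = no λ ()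
  ω _ _ _ _ ≟E τ _ _ _ _ = no λ ()
  τ _ _ _ _ ≟E α _ = no λ ()
  τ _ _ _ _ ≟E ω _ _ _ _ = no λ ()
  ω i a b c ≟E ω i′ a′ b′ c′ with i FinP.≟ i′ | a FinP.≟ a′ | b FinP.≟ b′ | c FinP.≟ c′
  ... | yes refl | yes refl | yes refl | yes refl = yes refl
  ... | no p | _ | _ | _ = no λ { refl → p refl }
  ... | yes _ | no p | _ | _ = no λ { refl → p refl }
  ... | yes _ | yes _ | no p | _ = no λ { refl → p refl }
  ... | yes _ | yes _ | yes _ | no p = no λ { refl → p refl }
  τ i a b c ≟E τ i′ a′ b′ c′ with i FinP.≟ i′ | a FinP.≟ a′ | b FinP.≟ b′ | c FinP.≟ c′
  ... | yes refl | yes refl | yes refl | yes refl = yes refl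
  ... | no p | _ | _ | _ = no λ { refl → p refl }
  ... | yes _ | no p | _ | _ = no λ { refl → p refl }
  ... | yes _ | yes _ | no p | _ = no λ { refl → p refl }
  ... | yes _ | yes _ | yes _ | no p = no λ { refl → p refl }

  val : Elem → ℕ
  val (α ℓ)       = A ℓ
  val (ω _ _ _ _) = w
  val (τ _ _ _ _) = t

  data Edge : Set where
    opening    : Fin m → Triple → Edge
    assignment : Fin m → Triple → Edge

  members : Edge → List Elem
  members (opening i (triple a b c _ _ _))    = ω i a b c ∷ []
  members (assignment i (triple a b c _ _ _)) =
    α a ∷ α b ∷ α c ∷ ω i a b c ∷ τ i a b c ∷ []

  C : ℕ
  C = m * (2 ^ w + 2 ^ (t + B))

  instanceΦ : OCP
  instanceΦ = record
    { Elem    = Elem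
    ; _≟ₑ_    = _≟E_
    ; Edge    = Edge
    ; members = members
    ; S       = map α (allFin n)
    ; val     = val
    ; budget  = C
    }

module Submission where

-- An edge whose residual set has weight u pays 2^u. If the residual set has α-weight a > 0, it
-- also contains τ_iX (only E_iX contains τ_iX, and once τ_iX is covered so are the α's of E_iX);
-- as u ↦ 2^u is superadditive, the edge then pays at least 2^(a+1), plus 2^w if its ω_iX is new
-- too. Every element is paid for exactly once and τ_iX never without ω_iX, so at least as many ω's
-- are paid for as there are edges of positive α-weight. Those α-weights are at most B and sum to
-- mB: if there are more than m of them, the ω's alone cost (m+1) 2^w ≥ C because 2^w ≥ m 2^(B+1);
-- otherwise there are exactly m, all equal to B, and the cost is at least m (2^w + 2^(B+1)) = C.
-- Opening and then assigning each triplet of a 3-partition attains C.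

open import Data.Bool using (if_then_else_)
open import Data.Empty using (⊥; ⊥-elim)
open import Data.Fin using (Fin; toℕ)
import Data.Fin.Properties as Fin
open import Data.List using (List; []; _∷_; _++_; [_]; map; concat; filter; allFin; length)
open import Data.List.Membership.Propositional using (_∈_; _∉_)
open import Data.List.Membership.Propositional.Properties
  using (∈-∃++; ∈-++⁻; ∈-++⁺ˡ; ∈-++⁺ʳ; ∈-filter⁺; ∈-filter⁻; ∈-deduplicate⁺; ∈-deduplicate⁻; ∈-map⁻; ∈-map⁺; ∈-allFin)
import Data.List.Membership.DecPropositional as DecMembership
open import Data.List.Properties using (length-tabulate)
open import Data.List.Relation.Unary.All using (All; []; _∷_)
import Data.List.Relation.Unary.All as All
open import Data.List.Relation.Unary.AllPairs using (AllPairs; []; _∷_)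
import Data.List.Relation.Unary.AllPairs.Properties as AllPairs
open import Data.List.Relation.Unary.Any using (here; there)
open import Data.List.Relation.Unary.Unique.Propositional using (Unique)
import Data.List.Relation.Unary.Unique.Propositional.Properties as Unique
open import Data.List.Relation.Unary.Unique.DecPropositional.Properties using (deduplicate-!)
open import Data.Nat using (ℕ; zero; suc; _+_; _*_; _^_; _∸_; _≤_; _<_; _<?_; z≤n; s≤s; >-nonZero; ⌊_/2⌋; ⌈_/2⌉)
open import Data.Nat.Induction using (<-rec)
open import Data.Nat.ListAction using (sum)
open import Data.Nat.Logarithm using (⌈log₂_⌉; ⌈log₂⌉-mono-≤; ⌈log₂⌈n/2⌉⌉≡⌈log₂n⌉∸1)
open import Data.Nat.Properties
open import Algebra.Properties.CommutativeSemigroup +-commutativeSemigroup using (interchange; x∙yz≈y∙xz)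
open import Data.Nat.Tactic.RingSolver using (solve-∀)
open import Data.Product using (Σ; _×_; _,_; ∃; proj₁; proj₂)
open import Data.Sum using (inj₁; inj₂)
open import Defs
open import Function using (_∘_; id)
open import Relation.Binary.PropositionalEquality hiding ([_])
open import Relation.Nullary using (¬?; yes; no)
open import Relation.Nullary.Decidable using (⌊_⌋)
open import Relation.Unary using (Decidable)

∑ : {X : Set} → (X → ℕ) → List X → ℕ
∑ f xs = sum (map f xs)

module _ {X : Set} where

  ∑-++ : ∀ (f : X → ℕ) xs ys → ∑ f (xs ++ ys) ≡ ∑ f xs + ∑ f ys
  ∑-++ f []       ys = refl
  ∑-++ f (x ∷ xs) ys = trans (cong (f x +_) (∑-++ f xs ys)) (sym (+-assoc (f x) _ _))

  ∑-concat : ∀ (f : X → ℕ) xss → ∑ f (concat xss) ≡ ∑ (∑ f) xss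
  ∑-concat f []         = refl
  ∑-concat f (xs ∷ xss) = trans (∑-++ f xs (concat xss)) (cong (∑ f xs +_) (∑-concat f xss))

  ∑-cong : ∀ {f g : X → ℕ} {xs} → All (λ x → f x ≡ g x) xs → ∑ f xs ≡ ∑ g xs
  ∑-cong []             = refl
  ∑-cong (fx≡gx ∷ ≡s) = cong₂ _+_ fx≡gx (∑-cong ≡s)

  ∑-+ : ∀ (f g : X → ℕ) xs → ∑ (λ x → f x + g x) xs ≡ ∑ f xs + ∑ g xs
  ∑-+ f g []       = refl
  ∑-+ f g (x ∷ xs) = trans (cong (f x + g x +_) (∑-+ f g xs)) (interchange (f x) (g x) (∑ f xs) (∑ g xs))

  ∑-* : ∀ c (f : X → ℕ) xs → ∑ (λ x → c * f x) xs ≡ c * ∑ f xs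
  ∑-* c f []       = sym (*-zeroʳ c)
  ∑-* c f (x ∷ xs) = trans (cong (c * f x +_) (∑-* c f xs)) (sym (*-distribˡ-+ c (f x) (∑ f xs)))

  ∑-mono : ∀ {f g : X → ℕ} {xs} → All (λ x → f x ≤ g x) xs → ∑ f xs ≤ ∑ g xs
  ∑-mono []         = z≤n
  ∑-mono (fx≤gx ∷ ≤s) = +-mono-≤ fx≤gx (∑-mono ≤s)

  ∑-tight : ∀ {f g : X → ℕ} {xs} → All (λ x → f x ≤ g x) xs → ∑ g xs ≤ ∑ f xs →
            All (λ x → f x ≡ g x) xs
  ∑-tight []           _ = []
  ∑-tight {f} {g} {x ∷ xs} (fx≤gx ∷ ≤s) ∑g≤∑f = ≤-antisym fx≤gx gx≤fx ∷ ∑-tight ≤s ∑g≤∑f′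
    where
    gx≤fx : g x ≤ f x
    gx≤fx = +-cancelʳ-≤ (∑ g xs) (g x) (f x) (≤-trans ∑g≤∑f (+-monoʳ-≤ (f x) (∑-mono ≤s)))
    ∑g≤∑f′ : ∑ g xs ≤ ∑ f xs
    ∑g≤∑f′ = +-cancelˡ-≤ (g x) (∑ g xs) (∑ f xs) (≤-trans ∑g≤∑f (+-monoˡ-≤ (∑ f xs) fx≤gx))

  ∑-filter : ∀ {P : X → Set} (P? : Decidable P) (f : X → ℕ) xs →
             ∑ (λ x → if ⌊ P? x ⌋ then f x else 0) xs ≡ ∑ f (filter P? xs)
  ∑-filter P? f []       = refl
  ∑-filter P? f (x ∷ xs) with P? x
  ... | yes _ = cong (f x +_) (∑-filter P? f xs)
  ... | no  _ = ∑-filter P? f xs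

  ∑-map : ∀ {Y : Set} (f : Y → ℕ) (g : X → Y) xs → ∑ f (map g xs) ≡ ∑ (f ∘ g) xs
  ∑-map f g []       = refl
  ∑-map f g (x ∷ xs) = cong (f (g x) +_) (∑-map f g xs)

  ∈⇒≤∑ : ∀ (f : X → ℕ) {x xs} → x ∈ xs → f x ≤ ∑ f xs
  ∈⇒≤∑ f {xs = y ∷ ys} (here refl) = m≤m+n (f y) (∑ f ys)
  ∈⇒≤∑ f {xs = y ∷ ys} (there x∈ys) = m≤n⇒m≤o+n (f y) (∈⇒≤∑ f x∈ys)

  ∑-pos⇒∃ : ∀ (f : X → ℕ) xs → 0 < ∑ f xs → ∃ λ x → x ∈ xs × 0 < f x
  ∑-pos⇒∃ f (x ∷ xs) 0<∑ with f x in fx≡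
  ... | suc _ = x , here refl , subst (0 <_) (sym fx≡) (s≤s z≤n)
  ... | zero  with ∑-pos⇒∃ f xs 0<∑
  ...   | y , y∈xs , 0<fy = y , there y∈xs , 0<fy

  ∑-mono-⊆ : ∀ (f : X → ℕ) {xs ys} → Unique xs → (∀ {x} → x ∈ xs → 0 < f x → x ∈ ys) →
             ∑ f xs ≤ ∑ f ys
  ∑-mono-⊆ f {[]}     _            _   = z≤n
  ∑-mono-⊆ f {x ∷ xs} {ys} (x∉xs ∷ xs!) sub with f x in fx≡
  ... | zero  = ∑-mono-⊆ f xs! (sub ∘ there)
  ... | suc k with ∈-∃++ (sub (here refl) (subst (0 <_) (sym fx≡) (s≤s z≤n)))
  ...   | ys₁ , ys₂ , refl = begin
    suc k + ∑ f xs              ≤⟨ +-monoʳ-≤ (suc k) (∑-mono-⊆ f xs! sub′) ⟩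
    suc k + ∑ f (ys₁ ++ ys₂)     ≡⟨ cong (suc k +_) (∑-++ f ys₁ ys₂) ⟩
    suc k + (∑ f ys₁ + ∑ f ys₂)  ≡⟨ x∙yz≈y∙xz (suc k) (∑ f ys₁) (∑ f ys₂) ⟩
    ∑ f ys₁ + (suc k + ∑ f ys₂)  ≡⟨ cong (λ fx → ∑ f ys₁ + (fx + ∑ f ys₂)) (sym fx≡) ⟩
    ∑ f ys₁ + ∑ f (x ∷ ys₂)      ≡⟨ sym (∑-++ f ys₁ (x ∷ ys₂)) ⟩
    ∑ f (ys₁ ++ x ∷ ys₂)         ∎
    where
    open ≤-Reasoning
    sub′ : ∀ {y} → y ∈ xs → 0 < f y → y ∈ ys₁ ++ ys₂
    sub′ y∈xs 0<fy with ∈-++⁻ ys₁ (sub (there y∈xs) 0<fy)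
    ... | inj₁ y∈ys₁          = ∈-++⁺ˡ y∈ys₁
    ... | inj₂ (here refl)    = ⊥-elim (All.lookup x∉xs y∈xs refl)
    ... | inj₂ (there y∈ys₂)  = ∈-++⁺ʳ ys₁ y∈ys₂

m+n≤m*n : ∀ {m n} → 2 ≤ m → 2 ≤ n → m + n ≤ m * n
m+n≤m*n {suc (suc m)} {suc (suc n)} (s≤s (s≤s z≤n)) (s≤s (s≤s z≤n)) =
  subst (2 + m + (2 + n) ≤_) (sym (expand m n)) (m≤m+n _ _)
  where
  expand : ∀ m n → (2 + m) * (2 + n) ≡ 2 + m + (2 + n) + (m + n + m * n)
  expand = solve-∀

n≤2^⌈log₂n⌉ : ∀ n → n ≤ 2 ^ ⌈log₂ n ⌉
n≤2^⌈log₂n⌉ = <-rec (λ n → n ≤ 2 ^ ⌈log₂ n ⌉) bound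
  where
  bound : ∀ n → (∀ {k} → k < n → k ≤ 2 ^ ⌈log₂ k ⌉) → n ≤ 2 ^ ⌈log₂ n ⌉
  bound 0                 _  = z≤n
  bound 1                 _  = s≤s z≤n
  bound n@(suc (suc n-2)) ih = begin
    n                           ≡⟨ sym (⌊n/2⌋+⌈n/2⌉≡n n) ⟩
    ⌊ n /2⌋ + ⌈ n /2⌉           ≤⟨ +-monoˡ-≤ ⌈ n /2⌉ (⌊n/2⌋≤⌈n/2⌉ n) ⟩
    ⌈ n /2⌉ + ⌈ n /2⌉           ≡⟨ cong (⌈ n /2⌉ +_) (sym (+-identityʳ ⌈ n /2⌉)) ⟩
    2 * ⌈ n /2⌉                 ≤⟨ *-monoʳ-≤ 2 (ih (⌈n/2⌉<n n-2)) ⟩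
    2 * 2 ^ ⌈log₂ ⌈ n /2⌉ ⌉     ≡⟨ cong (λ k → 2 ^ suc k) (⌈log₂⌈n/2⌉⌉≡⌈log₂n⌉∸1 n) ⟩
    2 ^ suc (⌈log₂ n ⌉ ∸ 1)      ≡⟨ cong (2 ^_) (m+[n∸m]≡n (⌈log₂⌉-mono-≤ {2} {n} (s≤s (s≤s z≤n)))) ⟩
    2 ^ ⌈log₂ n ⌉               ∎
    where open ≤-Reasoning

module OrderedCovering (P : OCP) where
  open OCP P
  open OCPDefs P
  open DecMembership _≟ₑ_ using (_∈?_)

  residual : List Edge → Edge → List Elem
  residual prev e = filter (λ x → ¬? (x ∈? ⋃ prev)) (set e)

  residuals : List Edge → List Edge → List (List Elem)
  residuals prev []       = []
  residuals prev (e ∷ es) = residual prev e ∷ residuals (prev ++ [ e ]) es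

  costFrom≡∑ : ∀ prev es → costFrom prev es ≡ ∑ (partialCost ∘ ∑ val) (residuals prev es)
  costFrom≡∑ prev []       = refl
  costFrom≡∑ prev (e ∷ es) = cong (partialCost (residualWeight prev e) +_) (costFrom≡∑ (prev ++ [ e ]) es)

  All-residuals : ∀ {Q : List Elem → Set} → (∀ prev e → Q (residual prev e)) →
                  ∀ prev es → All Q (residuals prev es)
  All-residuals Q-residual prev []       = []
  All-residuals Q-residual prev (e ∷ es) = Q-residual prev e ∷ All-residuals Q-residual (prev ++ [ e ]) es

  ∈-⋃⁺ : ∀ {x e} {es} → e ∈ es → x ∈ members e → x ∈ ⋃ es
  ∈-⋃⁺ {es = e ∷ es}  (here refl) x∈e = ∈-++⁺ˡ (∈-deduplicate⁺ _≟ₑ_ x∈e)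
  ∈-⋃⁺ {es = e′ ∷ es} (there e∈es) x∈e = ∈-++⁺ʳ (set e′) (∈-⋃⁺ e∈es x∈e)

  ∈-⋃⁻ : ∀ {x} es → x ∈ ⋃ es → ∃ λ e → e ∈ es × x ∈ members e
  ∈-⋃⁻ (e ∷ es) x∈⋃ with ∈-++⁻ (set e) x∈⋃
  ... | inj₁ x∈e  = e , here refl , ∈-deduplicate⁻ _≟ₑ_ (members e) x∈e
  ... | inj₂ x∈es with ∈-⋃⁻ es x∈es
  ...   | e′ , e′∈es , x∈e′ = e′ , there e′∈es , x∈e′

  ⋃-snoc⁺ˡ : ∀ {x} prev e → x ∈ ⋃ prev → x ∈ ⋃ (prev ++ [ e ])
  ⋃-snoc⁺ˡ prev e x∈prev with ∈-⋃⁻ prev x∈prev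
  ... | e′ , e′∈prev , x∈e′ = ∈-⋃⁺ (∈-++⁺ˡ e′∈prev) x∈e′

  ⋃-snoc⁺ʳ : ∀ {x} prev e → x ∈ members e → x ∈ ⋃ (prev ++ [ e ])
  ⋃-snoc⁺ʳ prev e = ∈-⋃⁺ (∈-++⁺ʳ prev (here refl))

  ∈-residual⁻ : ∀ {x} prev e → x ∈ residual prev e → x ∈ members e × x ∉ ⋃ prev
  ∈-residual⁻ prev e x∈r with ∈-filter⁻ (λ x → ¬? (x ∈? ⋃ prev)) x∈r
  ... | x∈e , x∉prev = ∈-deduplicate⁻ _≟ₑ_ (members e) x∈e , x∉prev

  ∈-residual⁺ : ∀ {x} prev e → x ∈ members e → x ∉ ⋃ prev → x ∈ residual prev e
  ∈-residual⁺ prev e x∈e = ∈-filter⁺ (λ x → ¬? (x ∈? ⋃ prev)) (∈-deduplicate⁺ _≟ₑ_ x∈e)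

  residual-unique : ∀ prev e → Unique (residual prev e)
  residual-unique prev e = Unique.filter⁺ (λ x → ¬? (x ∈? ⋃ prev)) (deduplicate-! _≟ₑ_ (members e))

  ∑-residual≤∑-members : ∀ (f : Elem → ℕ) prev e → ∑ f (residual prev e) ≤ ∑ f (members e)
  ∑-residual≤∑-members f prev e =
    ∑-mono-⊆ f (residual-unique prev e) (λ x∈r _ → proj₁ (∈-residual⁻ prev e x∈r))

  -- The elements paid for by the ordered covering, each at the first edge that covers it.
  fresh : List Edge → List Edge → List Elem
  fresh prev es = concat (residuals prev es)

  ∈-fresh⁻ : ∀ {x} prev es → x ∈ fresh prev es → x ∉ ⋃ prev × x ∈ ⋃ es
  ∈-fresh⁻ prev (e ∷ es) x∈fresh with ∈-++⁻ (residual prev e) x∈fresh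
  ... | inj₁ x∈r with ∈-residual⁻ prev e x∈r
  ...   | x∈e , x∉prev = x∉prev , ∈-⋃⁺ {es = e ∷ es} (here refl) x∈e
  ∈-fresh⁻ prev (e ∷ es) x∈fresh | inj₂ x∈rest with ∈-fresh⁻ (prev ++ [ e ]) es x∈rest
  ...   | x∉prev+e , x∈es = x∉prev+e ∘ ⋃-snoc⁺ˡ prev e , ∈-++⁺ʳ (set e) x∈es

  fresh-unique : ∀ prev es → Unique (fresh prev es)
  fresh-unique prev []       = []
  fresh-unique prev (e ∷ es) =
    Unique.++⁺ (residual-unique prev e) (fresh-unique (prev ++ [ e ]) es) disjoint
    where
    disjoint : ∀ {x} → x ∈ residual prev e × x ∈ fresh (prev ++ [ e ]) es → ⊥
    disjoint (x∈r , x∈rest) =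
      proj₁ (∈-fresh⁻ (prev ++ [ e ]) es x∈rest) (⋃-snoc⁺ʳ prev e (proj₁ (∈-residual⁻ prev e x∈r)))

  ∈-⋃⇒∈-fresh : ∀ {x} prev es → x ∈ ⋃ es → x ∉ ⋃ prev → x ∈ fresh prev es
  ∈-⋃⇒∈-fresh {x} prev (e ∷ es) x∈⋃ x∉prev with x ∈? ⋃ (prev ++ [ e ]) | ∈-⋃⁻ (e ∷ es) x∈⋃
  ... | no x∉prev+e | _ , here refl , x∈e = ⊥-elim (x∉prev+e (⋃-snoc⁺ʳ prev e x∈e))
  ... | no x∉prev+e | e′ , there e′∈es , x∈e′ =
    ∈-++⁺ʳ (residual prev e) (∈-⋃⇒∈-fresh (prev ++ [ e ]) es (∈-⋃⁺ e′∈es x∈e′) x∉prev+e)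
  ... | yes x∈prev+e | _ with ∈-⋃⁻ (prev ++ [ e ]) x∈prev+e
  ...   | e′ , e′∈prev+e , x∈e′ with ∈-++⁻ prev e′∈prev+e
  ...     | inj₁ e′∈prev        = ⊥-elim (x∉prev (∈-⋃⁺ e′∈prev x∈e′))
  ...     | inj₂ (here refl)    = ∈-++⁺ˡ (∈-residual⁺ prev e x∈e′ x∉prev)

  partialCost-mono : ∀ {u v} → u ≤ v → partialCost u ≤ partialCost v
  partialCost-mono {zero}              _   = z≤n
  partialCost-mono {suc u} {suc v} u≤v = ^-monoʳ-≤ 2 u≤v

  partialCost-pos : ∀ {u} → 0 < u → partialCost u ≡ 2 ^ u
  partialCost-pos {suc u} _ = refl

  partialCost≤2^ : ∀ u → partialCost u ≤ 2 ^ u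
  partialCost≤2^ zero    = z≤n
  partialCost≤2^ (suc u) = ≤-refl

  partialCost-double : ∀ u → 2 * partialCost u ≤ partialCost (suc u)
  partialCost-double zero    = z≤n
  partialCost-double (suc u) = ≤-refl

  partialCost-superadditive : ∀ u v → partialCost u + partialCost v ≤ partialCost (u + v)
  partialCost-superadditive zero    v      = ≤-refl
  partialCost-superadditive (suc u) zero   =
    ≤-reflexive (trans (+-identityʳ _) (cong partialCost (sym (+-identityʳ (suc u)))))
  partialCost-superadditive (suc u) (suc v) = begin
    2 ^ suc u + 2 ^ suc v   ≤⟨ m+n≤m*n (2≤2^suc u) (2≤2^suc v) ⟩
    2 ^ suc u * 2 ^ suc v   ≡⟨ sym (^-distribˡ-+-* 2 (suc u) (suc v)) ⟩
    2 ^ (suc u + suc v)     ∎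
    where
    open ≤-Reasoning
    2≤2^suc : ∀ k → 2 ≤ 2 ^ suc k
    2≤2^suc k = *-monoʳ-≤ 2 (m^n>0 2 k)

module Reduction (m : ℕ) (A : Fin (3 * m) → ℕ) (B : ℕ) where
  open Φ m A B
  open OCPDefs instanceΦ
  open OrderedCovering instanceΦ
  open DecMembership _≟E_ using (_∈?_)

  αWeight ωCount τCount : Elem → ℕ
  αWeight (α ℓ) = A ℓ
  αWeight _     = 0
  ωCount (ω _ _ _ _) = 1
  ωCount _           = 0
  τCount (τ _ _ _ _) = 1
  τCount _           = 0

  val-split : ∀ x → val x ≡ αWeight x + w * ωCount x + τCount x
  val-split (α ℓ)       = sym (trans (+-identityʳ _) (trans (cong (A ℓ +_) (*-zeroʳ w)) (+-identityʳ (A ℓ))))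
  val-split (ω _ _ _ _) = sym (trans (+-identityʳ _) (*-identityʳ w))
  val-split (τ _ _ _ _) = sym (cong (_+ 1) (*-zeroʳ w))

  ∑val-split : ∀ xs → ∑ val xs ≡ ∑ αWeight xs + w * ∑ ωCount xs + ∑ τCount xs
  ∑val-split xs = begin
    ∑ val xs
      ≡⟨ ∑-cong (All.universal val-split xs) ⟩
    ∑ (λ x → αWeight x + w * ωCount x + τCount x) xs
      ≡⟨ ∑-+ _ τCount xs ⟩
    ∑ (λ x → αWeight x + w * ωCount x) xs + ∑ τCount xs
      ≡⟨ cong (_+ ∑ τCount xs) (∑-+ αWeight _ xs) ⟩
    ∑ αWeight xs + ∑ (λ x → w * ωCount x) xs + ∑ τCount xs
      ≡⟨ cong (λ y → ∑ αWeight xs + y + ∑ τCount xs) (∑-* w ωCount xs) ⟩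
    ∑ αWeight xs + w * ∑ ωCount xs + ∑ τCount xs
      ∎
    where open ≡-Reasoning

  ∑ωCount-members : ∀ e → ∑ ωCount (members e) ≡ 1
  ∑ωCount-members (opening    _ (triple _ _ _ _ _ _)) = refl
  ∑ωCount-members (assignment _ (triple _ _ _ _ _ _)) = refl

  ∑τCount-members : ∀ e → ∑ τCount (members e) ≤ 1
  ∑τCount-members (opening    _ (triple _ _ _ _ _ _)) = z≤n
  ∑τCount-members (assignment _ (triple _ _ _ _ _ _)) = ≤-refl

  ∑αWeight-members : ∀ e → ∑ αWeight (members e) ≤ B
  ∑αWeight-members (opening    _ (triple _ _ _ _ _ _))        = z≤n
  ∑αWeight-members (assignment _ (triple a b c _ _ weight≡B)) = ≤-reflexive (begin
    A a + (A b + (A c + 0))  ≡⟨ cong (λ z → A a + (A b + z)) (+-identityʳ (A c)) ⟩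
    A a + (A b + A c)        ≡⟨ sym (+-assoc (A a) (A b) (A c)) ⟩
    A a + A b + A c          ≡⟨ weight≡B ⟩
    B                        ∎)
    where open ≡-Reasoning

  -- Only the assignment edge E_iX contains τ_iX.
  τ-covered : ∀ {i a b c} es → τ i a b c ∈ ⋃ es →
              α a ∈ ⋃ es × α b ∈ ⋃ es × α c ∈ ⋃ es × ω i a b c ∈ ⋃ es
  τ-covered es τ∈⋃ with ∈-⋃⁻ es τ∈⋃
  ... | opening _ (triple _ _ _ _ _ _) , _ , here ()
  ... | opening _ (triple _ _ _ _ _ _) , _ , there ()
  ... | assignment _ (triple _ _ _ _ _ _) , e∈es , there (there (there (there (here refl)))) =
    ∈-⋃⁺ e∈es (here refl) , ∈-⋃⁺ e∈es (there (here refl)) ,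
    ∈-⋃⁺ e∈es (there (there (here refl))) , ∈-⋃⁺ e∈es (there (there (there (here refl))))

  α-residual⇒τ-residual : ∀ prev e → 0 < ∑ αWeight (residual prev e) → 1 ≤ ∑ τCount (residual prev e)
  α-residual⇒τ-residual prev e 0<∑α with ∑-pos⇒∃ αWeight (residual prev e) 0<∑α
  ... | x , x∈r , 0<αx = τ∈r e (∈-residual⁻ prev e x∈r) 0<αx
    where
    τ∈r : ∀ e {x} → x ∈ members e × x ∉ ⋃ prev → 0 < αWeight x → 1 ≤ ∑ τCount (residual prev e)
    τ∈r (opening _ (triple _ _ _ _ _ _)) (here refl , _) ()
    τ∈r e@(assignment i (triple a b c _ _ _)) (x∈e , x∉prev) 0<αx with τ i a b c ∈? ⋃ prev
    ... | no τ∉prev = ∈⇒≤∑ τCount (∈-residual⁺ prev e (there (there (there (there (here refl))))) τ∉prev)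
    ... | yes τ∈prev with τ-covered prev τ∈prev | x∈e
    ...   | a∈ , _ , _ , _ | here refl                 = ⊥-elim (x∉prev a∈)
    ...   | _ , b∈ , _ , _ | there (here refl)         = ⊥-elim (x∉prev b∈)
    ...   | _ , _ , c∈ , _ | there (there (here refl)) = ⊥-elim (x∉prev c∈)
    ...   | _ , _ , _ , _  | there (there (there (here refl))) with () ← 0<αx
    ...   | _ , _ , _ , _  | there (there (there (there (here refl)))) with () ← 0<αx

  W : ℕ
  W = 2 ^ w

  m*2^[1+B]≤W : m * 2 ^ suc B ≤ W
  m*2^[1+B]≤W = begin
    m * 2 ^ suc B                ≤⟨ *-monoˡ-≤ (2 ^ suc B) (n≤2^⌈log₂n⌉ m) ⟩
    2 ^ ⌈log₂ m ⌉ * 2 ^ suc B    ≡⟨ *-comm (2 ^ ⌈log₂ m ⌉) (2 ^ suc B) ⟩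
    2 ^ suc B * 2 ^ ⌈log₂ m ⌉    ≡⟨ sym (^-distribˡ-+-* 2 (suc B) ⌈log₂ m ⌉) ⟩
    2 ^ (suc B + ⌈log₂ m ⌉)      ≤⟨ ^-monoʳ-≤ 2 (m≤m+n (suc B + ⌈log₂ m ⌉) 1) ⟩
    W                            ∎
    where open ≤-Reasoning

  W*k≤partialCost[w*k] : ∀ k → k ≤ 1 → W * k ≤ partialCost (w * k)
  W*k≤partialCost[w*k] 0 _ = ≤-reflexive (trans (*-zeroʳ W) (cong partialCost (sym (*-zeroʳ w))))
  W*k≤partialCost[w*k] 1 _ = ≤-reflexive (trans (*-identityʳ W) (cong partialCost (sym (*-identityʳ w))))
  W*k≤partialCost[w*k] (suc (suc _)) (s≤s ())

  2*partialCost≤partialCost[+] : ∀ a k → a ≤ B * k → 2 * partialCost a ≤ partialCost (a + k)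
  2*partialCost≤partialCost[+] a 0       a≤B*0 with z≤n ← subst (a ≤_) (*-zeroʳ B) a≤B*0 = z≤n
  2*partialCost≤partialCost[+] a (suc k) _ =
    ≤-trans (partialCost-double a) (partialCost-mono (m<m+n a (s≤s z≤n)))

  2*partialCost[B*k] : 0 < B → ∀ k → k ≤ 1 → 2 * partialCost (B * k) ≡ 2 ^ suc B * k
  2*partialCost[B*k] _   0 _ rewrite *-zeroʳ B | *-zeroʳ (2 ^ suc B) = refl
  2*partialCost[B*k] 0<B 1 _ rewrite *-identityʳ B | *-identityʳ (2 ^ suc B) =
    cong (2 *_) (partialCost-pos 0<B)
  2*partialCost[B*k] _   (suc (suc _)) (s≤s ())

  -- A residual set is summarised by its α-weight wα and its numbers nω, nτ of elements ω and τ.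
  module _ {X : Set} (wα nω nτ : X → ℕ) where

    Admissible : X → Set
    Admissible x = nω x ≤ 1 × nτ x ≤ 1 × wα x ≤ B * nτ x

    cost : X → ℕ
    cost x = partialCost (wα x + w * nω x + nτ x)

    cost-split : ∀ {x} → Admissible x → W * nω x + 2 * partialCost (wα x) ≤ cost x
    cost-split {x} (nω≤1 , _ , wα≤B*nτ) = begin
      W * nω x + 2 * partialCost (wα x)
        ≤⟨ +-mono-≤ (W*k≤partialCost[w*k] (nω x) nω≤1)
                    (2*partialCost≤partialCost[+] (wα x) (nτ x) wα≤B*nτ) ⟩
      partialCost (w * nω x) + partialCost (wα x + nτ x)
        ≤⟨ partialCost-superadditive (w * nω x) (wα x + nτ x) ⟩
      partialCost (w * nω x + (wα x + nτ x))
        ≡⟨ cong partialCost (x∙yz≈y∙xz (w * nω x) (wα x) (nτ x)) ⟩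
      partialCost (wα x + (w * nω x + nτ x))
        ≡⟨ cong partialCost (sym (+-assoc (wα x) (w * nω x) (nτ x))) ⟩
      cost x
        ∎
      where open ≤-Reasoning

    α-charge : List X → ℕ
    α-charge = ∑ (λ x → 2 * partialCost (wα x))

    charge-lower-bound : 0 < B → ∀ xs → All Admissible xs → m * B ≤ ∑ wα xs →
                          m * (W + 2 ^ suc B) ≤ W * ∑ nτ xs + α-charge xs
    charge-lower-bound 0<B xs admissible mB≤∑wα with m <? ∑ nτ xs
    ... | yes m<∑nτ = begin
      m * (W + 2 ^ suc B)      ≡⟨ *-distribˡ-+ m W (2 ^ suc B) ⟩
      m * W + m * 2 ^ suc B    ≤⟨ +-monoʳ-≤ (m * W) m*2^[1+B]≤W ⟩
      m * W + W                ≡⟨ +-comm (m * W) W ⟩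
      suc m * W                ≡⟨ *-comm (suc m) W ⟩
      W * suc m                ≤⟨ *-monoʳ-≤ W m<∑nτ ⟩
      W * ∑ nτ xs              ≤⟨ m≤m+n (W * ∑ nτ xs) (α-charge xs) ⟩
      W * ∑ nτ xs + α-charge xs ∎
      where open ≤-Reasoning
    ... | no m≮∑nτ = ≤-reflexive (begin
      m * (W + 2 ^ suc B)                      ≡⟨ *-distribˡ-+ m W (2 ^ suc B) ⟩
      m * W + m * 2 ^ suc B                    ≡⟨ cong₂ _+_ (*-comm m W) (*-comm m (2 ^ suc B)) ⟩
      W * m + 2 ^ suc B * m                    ≡⟨ cong (λ k → W * k + 2 ^ suc B * k) m≡∑nτ ⟩
      W * ∑ nτ xs + 2 ^ suc B * ∑ nτ xs        ≡⟨ cong (W * ∑ nτ xs +_) (sym (∑-* (2 ^ suc B) nτ xs)) ⟩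
      W * ∑ nτ xs + ∑ (λ x → 2 ^ suc B * nτ x) xs
        ≡⟨ cong (W * ∑ nτ xs +_) (sym (∑-cong (All.zipWith 2*partialCost[wα] (wα≡B*nτ , admissible)))) ⟩
      W * ∑ nτ xs + α-charge xs               ∎)
      where
      open ≡-Reasoning
      wα≤B*nτ : All (λ x → wα x ≤ B * nτ x) xs
      wα≤B*nτ = All.map (λ (_ , _ , wα≤B*nτ) → wα≤B*nτ) admissible
      m≡∑nτ : m ≡ ∑ nτ xs
      m≡∑nτ = ≤-antisym (*-cancelˡ-≤ B {{>-nonZero 0<B}} mB≤B∑nτ) (≮⇒≥ m≮∑nτ)
        where
        mB≤B∑nτ : B * m ≤ B * ∑ nτ xs
        mB≤B∑nτ = ≤-trans (≤-reflexive (*-comm B m))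
                    (≤-trans mB≤∑wα (≤-trans (∑-mono wα≤B*nτ) (≤-reflexive (∑-* B nτ xs))))
      -- Σ wα ≥ m B = B Σ nτ forces every α-weight to its maximum B nτ.
      wα≡B*nτ : All (λ x → wα x ≡ B * nτ x) xs
      wα≡B*nτ = ∑-tight wα≤B*nτ (≤-trans (≤-reflexive ∑B*nτ≡mB) mB≤∑wα)
        where
        ∑B*nτ≡mB : ∑ (λ x → B * nτ x) xs ≡ m * B
        ∑B*nτ≡mB = trans (∑-* B nτ xs) (trans (cong (B *_) (sym m≡∑nτ)) (*-comm B m))
      2*partialCost[wα] : ∀ {x} → wα x ≡ B * nτ x × Admissible x → 2 * partialCost (wα x) ≡ 2 ^ suc B * nτ x
      2*partialCost[wα] {x} (wα≡B*nτ , _ , nτ≤1 , _) =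
        trans (cong (λ k → 2 * partialCost k) wα≡B*nτ) (2*partialCost[B*k] 0<B (nτ x) nτ≤1)

    cost-lower-bound : 0 < B → ∀ xs → All Admissible xs → m * B ≤ ∑ wα xs → ∑ nτ xs ≤ ∑ nω xs →
                       m * (W + 2 ^ suc B) ≤ ∑ cost xs
    cost-lower-bound 0<B xs admissible mB≤∑wα ∑nτ≤∑nω = begin
      m * (W + 2 ^ suc B)                        ≤⟨ charge-lower-bound 0<B xs admissible mB≤∑wα ⟩
      W * ∑ nτ xs + α-charge xs                 ≤⟨ +-monoˡ-≤ (α-charge xs) (*-monoʳ-≤ W ∑nτ≤∑nω) ⟩
      W * ∑ nω xs + α-charge xs                 ≡⟨ cong (_+ α-charge xs) (sym (∑-* W nω xs)) ⟩
      ∑ (λ x → W * nω x) xs + α-charge xs       ≡⟨ sym (∑-+ _ _ xs) ⟩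
      ∑ (λ x → W * nω x + 2 * partialCost (wα x)) xs
                                                 ≤⟨ ∑-mono (All.map cost-split admissible) ⟩
      ∑ cost xs                                  ∎
      where open ≤-Reasoning

  ≤B⇒≤B*k : ∀ {a k} → a ≤ B → (0 < a → 1 ≤ k) → a ≤ B * k
  ≤B⇒≤B*k {zero}          _   _    = z≤n
  ≤B⇒≤B*k {suc _} {zero}  _   0<a⇒ with () ← 0<a⇒ (s≤s z≤n)
  ≤B⇒≤B*k {suc _} {suc k} a≤B _    = ≤-trans a≤B (m≤m*n B (suc k))

  residual-admissible : ∀ prev e → Admissible (∑ αWeight) (∑ ωCount) (∑ τCount) (residual prev e)
  residual-admissible prev e =
    ≤-trans (∑-residual≤∑-members ωCount prev e) (≤-reflexive (∑ωCount-members e)) ,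
    ≤-trans (∑-residual≤∑-members τCount prev e) (∑τCount-members e) ,
    ≤B⇒≤B*k (≤-trans (∑-residual≤∑-members αWeight prev e) (∑αWeight-members e))
            (α-residual⇒τ-residual prev e)

  mB≤∑αWeight : IsThreePartitionInstance m A B → ∀ es → IsOrderedCovering es →
                m * B ≤ ∑ (∑ αWeight) (residuals [] es)
  mB≤∑αWeight inst es covering = begin
    m * B                            ≡⟨ sym (IsThreePartitionInstance.total inst) ⟩
    ΣFin n A                         ≡⟨ sym (∑-map αWeight α (allFin n)) ⟩
    ∑ αWeight (map α (allFin n))     ≤⟨ ∑-mono-⊆ αWeight α-unique α∈fresh ⟩
    ∑ αWeight (fresh [] es)          ≡⟨ ∑-concat αWeight (residuals [] es) ⟩
    ∑ (∑ αWeight) (residuals [] es)  ∎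
    where
    open ≤-Reasoning
    α-unique : Unique (map α (allFin n))
    α-unique = Unique.map⁺ (λ { refl → refl }) (Unique.allFin⁺ n)
    α∈fresh : ∀ {x} → x ∈ map α (allFin n) → 0 < αWeight x → x ∈ fresh [] es
    α∈fresh x∈S _ = ∈-⋃⇒∈-fresh [] es (All.lookup covering x∈S) (λ ())

  swapωτ : Elem → Elem
  swapωτ (α ℓ)       = α ℓ
  swapωτ (ω i a b c) = τ i a b c
  swapωτ (τ i a b c) = ω i a b c

  swapωτ-injective : ∀ {x y} → swapωτ x ≡ swapωτ y → x ≡ y
  swapωτ-injective {x} {y} eq = trans (sym (involutive x)) (trans (cong swapωτ eq) (involutive y))
    where
    involutive : ∀ x → swapωτ (swapωτ x) ≡ x
    involutive (α _)       = refl
    involutive (ω _ _ _ _) = refl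
    involutive (τ _ _ _ _) = refl

  τCount≡ωCount∘swapωτ : ∀ x → τCount x ≡ ωCount (swapωτ x)
  τCount≡ωCount∘swapωτ (α _)       = refl
  τCount≡ωCount∘swapωτ (ω _ _ _ _) = refl
  τCount≡ωCount∘swapωτ (τ _ _ _ _) = refl

  -- Every paid-for τ_iX has its partner ω_iX paid for as well, and no element is paid twice.
  ∑τCount≤∑ωCount : ∀ es → ∑ (∑ τCount) (residuals [] es) ≤ ∑ (∑ ωCount) (residuals [] es)
  ∑τCount≤∑ωCount es = begin
    ∑ (∑ τCount) (residuals [] es)   ≡⟨ sym (∑-concat τCount (residuals [] es)) ⟩
    ∑ τCount xs                      ≡⟨ ∑-cong (All.universal τCount≡ωCount∘swapωτ xs) ⟩
    ∑ (ωCount ∘ swapωτ) xs           ≡⟨ sym (∑-map ωCount swapωτ xs) ⟩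
    ∑ ωCount (map swapωτ xs)         ≤⟨ ∑-mono-⊆ ωCount swapped-unique ω-partner ⟩
    ∑ ωCount xs                      ≡⟨ ∑-concat ωCount (residuals [] es) ⟩
    ∑ (∑ ωCount) (residuals [] es)   ∎
    where
    open ≤-Reasoning
    xs = fresh [] es
    swapped-unique : Unique (map swapωτ xs)
    swapped-unique = Unique.map⁺ swapωτ-injective (fresh-unique [] es)
    ω-partner : ∀ {y} → y ∈ map swapωτ xs → 0 < ωCount y → y ∈ xs
    ω-partner y∈ 0<ωy with ∈-map⁻ swapωτ y∈
    ... | τ _ _ _ _ , τ∈xs , refl =
      ∈-⋃⇒∈-fresh [] es (proj₂ (proj₂ (proj₂ (τ-covered es (proj₂ (∈-fresh⁻ [] es τ∈xs)))))) (λ ())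
    ... | α _       , _ , refl with () ← 0<ωy
    ... | ω _ _ _ _ , _ , refl with () ← 0<ωy

  F-lower-bound : IsThreePartitionInstance m A B → ∀ es → IsOrderedCovering es → C ≤ F es
  F-lower-bound inst es covering = begin
    C                                                 ≤⟨ cost-lower-bound (∑ αWeight) (∑ ωCount) (∑ τCount)
                                                           (IsThreePartitionInstance.B-pos inst) rs
                                                           (All-residuals residual-admissible [] es)
                                                           (mB≤∑αWeight inst es covering) (∑τCount≤∑ωCount es) ⟩
    ∑ (cost (∑ αWeight) (∑ ωCount) (∑ τCount)) rs     ≡⟨ ∑-cong (All.universal (cong partialCost ∘ sym ∘ ∑val-split) rs) ⟩
    ∑ (partialCost ∘ ∑ val) rs                        ≡⟨ sym (costFrom≡∑ [] es) ⟩
    F es                                              ∎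
    where
    open ≤-Reasoning
    rs = residuals [] es

  opening-cost : ∀ prev i tr → partialCost (residualWeight prev (opening i tr)) ≤ W
  opening-cost prev i tr@(triple _ _ _ _ _ _) = begin
    partialCost (∑ val (residual prev e))  ≤⟨ partialCost≤2^ (∑ val (residual prev e)) ⟩
    2 ^ ∑ val (residual prev e)            ≤⟨ ^-monoʳ-≤ 2 (∑-residual≤∑-members val prev e) ⟩
    2 ^ (w + 0)                            ≡⟨ cong (2 ^_) (+-identityʳ w) ⟩
    W                                      ∎
    where
    open ≤-Reasoning
    e = opening i tr

  assignment-cost : ∀ prev i tr →
                    partialCost (residualWeight (prev ++ [ opening i tr ]) (assignment i tr)) ≤ 2 ^ suc B
  assignment-cost prev i tr@(triple a b c _ _ _) =
    ≤-trans (partialCost≤2^ (∑ val r)) (^-monoʳ-≤ 2 weight≤1+B)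
    where
    prev′ = prev ++ [ opening i tr ]
    e = assignment i tr
    r = residual prev′ e
    ω-opened : ∀ {x} → x ∈ r → 0 < ωCount x → x ∈ []
    ω-opened x∈r 0<ωx with ∈-residual⁻ prev′ e x∈r
    ... | here refl                         , _ with () ← 0<ωx
    ... | there (here refl)                 , _ with () ← 0<ωx
    ... | there (there (here refl))         , _ with () ← 0<ωx
    ... | there (there (there (here refl))) , ω∉prev′ =
      ⊥-elim (ω∉prev′ (⋃-snoc⁺ʳ prev (opening i tr) (here refl)))
    ... | there (there (there (there (here refl)))) , _ with () ← 0<ωx
    weight≤1+B : ∑ val r ≤ suc B
    weight≤1+B = begin
      ∑ val r                                      ≡⟨ ∑val-split r ⟩
      ∑ αWeight r + w * ∑ ωCount r + ∑ τCount r    ≤⟨ +-mono-≤ (+-mono-≤ α≤B (*-monoʳ-≤ w ω≤0)) τ≤1 ⟩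
      B + w * 0 + 1                                ≡⟨ cong (λ k → B + k + 1) (*-zeroʳ w) ⟩
      B + 0 + 1                                    ≡⟨ trans (cong (_+ 1) (+-identityʳ B)) (+-comm B 1) ⟩
      suc B                                        ∎
      where
      open ≤-Reasoning
      α≤B = ≤-trans (∑-residual≤∑-members αWeight prev′ e) (∑αWeight-members e)
      ω≤0 = ∑-mono-⊆ ωCount (residual-unique prev′ e) ω-opened
      τ≤1 = proj₁ (proj₂ (residual-admissible prev′ e))

  toTriple : ∀ i xs → ∑ (λ _ → 1) xs ≡ 3 → ∑ A xs ≡ B → AllPairs (λ x y → toℕ x < toℕ y) xs →
             Σ Triple λ tr → ∀ {ℓ} → ℓ ∈ xs → α ℓ ∈ members (assignment i tr)
  toTriple i xs@(x ∷ y ∷ z ∷ []) refl ∑A≡B ((x<y ∷ _ ∷ []) ∷ (y<z ∷ []) ∷ [] ∷ []) =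
    triple x y z x<y y<z weight≡B , λ ℓ∈xs → ∈-++⁺ˡ (∈-map⁺ α ℓ∈xs)
    where
    weight≡B : A x + A y + A z ≡ B
    weight≡B = trans (+-assoc (A x) (A y) (A z))
                     (trans (cong (λ k → A x + (A y + k)) (sym (+-identityʳ (A z)))) ∑A≡B)

  module Schedule (g : Fin n → Fin m)
                  (partition : ∀ i → ΣFin n (λ ℓ → if ⌊ g ℓ Fin.≟ i ⌋ then 1 else 0) ≡ 3 ×
                                     ΣFin n (λ ℓ → if ⌊ g ℓ Fin.≟ i ⌋ then A ℓ else 0) ≡ B) where

    class : Fin m → List (Fin n)
    class i = filter (λ ℓ → g ℓ Fin.≟ i) (allFin n)

    class-triple : ∀ i → Σ Triple λ tr → ∀ {ℓ} → ℓ ∈ class i → α ℓ ∈ members (assignment i tr)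
    class-triple i =
      toTriple i (class i) (trans (sym (∑-filter (λ ℓ → g ℓ Fin.≟ i) _ (allFin n))) (proj₁ (partition i)))
                           (trans (sym (∑-filter (λ ℓ → g ℓ Fin.≟ i) A (allFin n))) (proj₂ (partition i)))
                           (AllPairs.filter⁺ (λ ℓ → g ℓ Fin.≟ i) (AllPairs.tabulate⁺-< id))

    tripleOf : Fin m → Triple
    tripleOf i = proj₁ (class-triple i)

    α∈tripleOf : ∀ ℓ → α ℓ ∈ members (assignment (g ℓ) (tripleOf (g ℓ)))
    α∈tripleOf ℓ = proj₂ (class-triple (g ℓ)) (∈-filter⁺ (λ ℓ′ → g ℓ′ Fin.≟ g ℓ) (∈-allFin ℓ) refl)

    schedule : List (Fin m) → List Edge
    schedule []       = []
    schedule (i ∷ is) = opening i (tripleOf i) ∷ assignment i (tripleOf i) ∷ schedule is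

    assignment∈schedule : ∀ {i is} → i ∈ is → assignment i (tripleOf i) ∈ schedule is
    assignment∈schedule (here refl)  = there (here refl)
    assignment∈schedule (there i∈is) = there (there (assignment∈schedule i∈is))

    schedule-covers : IsOrderedCovering (schedule (allFin m))
    schedule-covers = All.tabulate covers
      where
      covers : ∀ {x} → x ∈ map α (allFin n) → x ∈ ⋃ (schedule (allFin m))
      covers x∈S with ∈-map⁻ α x∈S
      ... | ℓ , _ , refl = ∈-⋃⁺ (assignment∈schedule (∈-allFin (g ℓ))) (α∈tripleOf ℓ)

    schedule-cost : ∀ prev is → costFrom prev (schedule is) ≤ length is * (W + 2 ^ suc B)
    schedule-cost prev []       = z≤n
    schedule-cost prev (i ∷ is) =
      ≤-trans (+-mono-≤ (opening-cost prev i (tripleOf i))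
                        (+-mono-≤ (assignment-cost prev i (tripleOf i)) (schedule-cost _ is)))
              (≤-reflexive (sym (+-assoc W (2 ^ suc B) _)))

    schedule-F≤C : F (schedule (allFin m)) ≤ C
    schedule-F≤C = subst (λ k → F (schedule (allFin m)) ≤ k * (W + 2 ^ suc B))
                         (length-tabulate {n = m} (λ i → i)) (schedule-cost [] (allFin m))

theorem3 : (m : ℕ) (A : Fin (3 * m) → ℕ) (B : ℕ) →
    IsThreePartitionInstance m A B →
    ThreePartitionYes m A B →
    OCPDefs.IsYes (Φ.instanceΦ m A B) ×
    Σ (List (OCP.Edge (Φ.instanceΦ m A B))) (λ es →
    OCPDefs.IsOptimalCoveringOfCost (Φ.instanceΦ m A B) es (Φ.C m A B))
theorem3 m A B inst (g , partition) =
  (es , schedule-covers , schedule-F≤C) ,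
  es , schedule-covers , ≤-antisym schedule-F≤C (F-lower-bound inst es schedule-covers) ,
  λ es′ covering′ → ≤-trans schedule-F≤C (F-lower-bound inst es′ covering′)
  where
  open Reduction m A B
  open Schedule g partition
  es = schedule (allFin m)
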